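{- Let $G$ be a map on an orientable surface, $D_0$ an orientation of $G$ and $f_0$ a face of $G$, and let $D_{\max}$ and $D_{\min}$ be the maximum and minimum elements of the distributive lattice $(O(G,D_0),\leq_{f_0})$. Then $\widetilde F_0$ is an oriented subgraph of $D_{\max}$ and $-\widetilde F_0$ (i.e. $\widetilde F_0$ with all edges reversed) is an oriented subgraph of $D_{\min}$.
   Context: A map is a graph embedded on an orientable surface with all faces homeomorphic to open disks (contractible cycles of length 1 or 2 allowed). Fix a reference orientation; walks and oriented subgraphs have characteristic flows $\phi\in\mathbb{Z}^E$; $\mathbb{F}$ is the subgroup generated by characteristic flows of counterclockwise facial walks; $0$-homologous means $\phi\in\mathbb{F}$. For orientations $D,D'$, $D\setminus D'$ is the oriented subgraph of $D$ formed by edges oriented differently in $D'$. $O(G,D_0)$ is the set of orientations $D$ with $D\setminus D_0$ $0$-homologous. Let $\mathcal{F}'$ be the counterclockwise facial walks of $G$ other than the one of $f_0$; a $0$-homologous oriented subgraph $T$ is counterclockwise if $\phi(T)=\sum_{F\in\mathcal{F}'}\lambda_F\phi(F)$ with all $\lambda_F\ge 0$; $D\leq_{f_0}D'$ iff $D\setminus D'$ is counterclockwise. This poset is a finite distributive lattice. An edge is rigid if it has the same orientation in all of $O(G,D_0)$; $\widetilde G$ is $G$ minus its rigid edges; $\widetilde F_0$ is the oriented subgraph formed by the boundary, oriented counterclockwise, of the face of $\widetilde G$ containing $f_0$. An oriented subgraph $S$ is an oriented subgraph of $D$ if each edge of $S$ has the same orientation in $D$. -}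

module Defs where

open import Data.Nat using (ℕ; zero; suc; _<_; _*_)
open import Data.Integer using (ℤ; +_; _+_; _-_; 0ℤ; 1ℤ; -1ℤ)
  renaming (_*_ to _*ℤ_)
open import Data.Fin using (Fin)
import Data.Fin as Fin
open import Data.Bool using (Bool; true; false; not; if_then_else_; _xor_)
open import Data.Product using (Σ; ∃; ∃-syntax; _×_; _,_; proj₁; proj₂)
open import Function using (_∘_; _↔_; Inverse)
open import Relation.Binary.PropositionalEquality using (_≡_)
open import Relation.Nullary using (¬_; Dec; does)
open import Data.Product.Properties using (≡-dec)
import Data.Fin.Properties as FinP
import Data.Bool.Properties as BoolP
open import Data.Nat using (_<?_)
open import Data.List using (List; upTo)
open import Data.List.Relation.Unary.Any using (Any; any?)

-- Edges are Fin m, each equipped with a reference orientation.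
-- A dart (e , b) is edge e traversed along the reference orientation
-- when b = true, against it when b = false.

Dart : ℕ → Set
Dart m = Fin m × Bool

α : ∀ {m} → Dart m → Dart m
α (e , b) = (e , not b)

_≟D_ : ∀ {m} (d d' : Dart m) → Dec (d ≡ d')
_≟D_ = ≡-dec FinP._≟_ BoolP._≟_

data Reach {m : ℕ} (σ : Dart m → Dart m) : Dart m → Dart m → Set where
  here  : ∀ {d} → Reach σ d d
  viaσ  : ∀ {d d'} → Reach σ (σ d) d' → Reach σ d d'
  viaα  : ∀ {d d'} → Reach σ (α d) d' → Reach σ d d'

-- A map: m edges, a rotation system σ (a permutation of darts giving the
-- cyclic order of darts around each vertex), connected.
record Map : Set where
  field
    m         : ℕ
    rot       : Dart m ↔ Dart m
    connected : ∀ d d' → Reach (Inverse.to rot) d d'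

  σ : Dart m → Dart m
  σ = Inverse.to rot

  -- face permutation; its orbits are the (counterclockwise) facial walks,
  -- the walk of a face traversing each of its darts in the dart's direction
  φ : Dart m → Dart m
  φ = σ ∘ α

  iter : ℕ → Dart m → Dart m
  iter zero    d = d
  iter (suc k) d = φ (iter k d)

  -- d' lies on the facial walk of the face containing dart d
  -- (the orbit of d under φ; orbits have length ≤ 2m)
  InFace : Dart m → Dart m → Set
  InFace d d' = Any (λ k → iter k d ≡ d') (upTo (2 * m))

  inFace? : ∀ d d' → Dec (InFace d d')
  inFace? d d' = any? (λ k → iter k d ≟D d') (upTo (2 * m))

open Map public

Flow : ℕ → Set
Flow m = Fin m → ℤ

sign : Bool → ℤ
sign true  = 1ℤ
sign false = -1ℤ

ind : ∀ {P : Set} → Dec P → ℤ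
ind p = if does p then 1ℤ else 0ℤ

-- characteristic flow of the counterclockwise facial walk of the face of d
faceFlow : (G : Map) → Dart (m G) → Flow (m G)
faceFlow G d e = ind (inFace? G d (e , true)) - ind (inFace? G d (e , false))

sumFin : ∀ n → (Fin n → ℤ) → ℤ
sumFin zero    f = 0ℤ
sumFin (suc n) f = f Fin.zero + sumFin n (f ∘ Fin.suc)

sumDart : ∀ m → (Dart m → ℤ) → ℤ
sumDart m f = sumFin m (λ e → f (e , true) + f (e , false))

-- linear combination of facial flows with coefficients indexed by darts
-- (the coefficient of a face is the sum of the coefficients of its darts)
combo : (G : Map) → (Dart (m G) → ℤ) → Flow (m G)
combo G c e = sumDart (m G) (λ d → c d *ℤ faceFlow G d e)

-- 0-homologous: in the subgroup 𝔽 generated by facial flows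
ZeroHom : (G : Map) → Flow (m G) → Set
ZeroHom G f = ∃[ c ] (∀ e → f e ≡ combo G c e)

-- counterclockwise w.r.t. face f0 (the face of dart d0): nonnegative
-- combination of facial flows of faces other than f0
CCW : (G : Map) → Dart (m G) → Flow (m G) → Set
CCW G d0 f = ∃[ c ] ((∀ d → InFace G d0 d → c d ≡ 0)
                      × (∀ e → f e ≡ combo G (+_ ∘ c) e))

-- Orientations: D e = true iff e is oriented as its reference orientation

Orientation : ℕ → Set
Orientation m = Fin m → Bool

-- characteristic flow of D ∖ D'
diffFlow : ∀ {m} → Orientation m → Orientation m → Flow m
diffFlow D D' e = if D e xor D' e then sign (D e) else 0ℤ

InO : (G : Map) → Orientation (m G) → Orientation (m G) → Set
InO G D0 D = ZeroHom G (diffFlow D D0)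

Leq : (G : Map) → Dart (m G) → Orientation (m G) → Orientation (m G) → Set
Leq G d0 D D' = CCW G d0 (diffFlow D D')

Rigid : (G : Map) → Orientation (m G) → Fin (m G) → Set
Rigid G D0 e = ∀ D D' → InO G D0 D → InO G D0 D' → D e ≡ D' e

-- darts whose (left) face lies in the face of G̃ containing f0:
-- faces of G glued across rigid (deleted) edges
data InRegion (G : Map) (D0 : Orientation (m G)) (d0 : Dart (m G))
     : Dart (m G) → Set where
  base  : ∀ {d} → InFace G d0 d → InRegion G D0 d0 d
  cross : ∀ {d} → InRegion G D0 d0 d → Rigid G D0 (proj₁ d)
          → InRegion G D0 d0 (α d)
  along : ∀ {d d'} → InRegion G D0 d0 d → InFace G d d'
          → InRegion G D0 d0 d'

-- darts of F̃0: boundary of that face of G̃, oriented counterclockwise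
InF̃0 : (G : Map) → Orientation (m G) → Dart (m G) → Dart (m G) → Set
InF̃0 G D0 d0 d = InRegion G D0 d0 d × ¬ Rigid G D0 (proj₁ d)

module Submission where

-- Let D ≤_{f0} D′ in O(G, D0), so that D ∖ D′ = Σ_F λ_F φ(F) with λ ≥ 0 and
-- λ_{f0} = 0.  Give every dart the weight λ_F of the face F on its left; the
-- flow of D ∖ D′ on an edge is then the weight of its forward dart minus the
-- weight of its backward dart.  Weights are constant along facial walks,
-- vanish on f0, and agree on both sides of a rigid edge (which carries no
-- flow), so they vanish on every dart of the face of G̃ containing f0.  Thus an
-- edge of F̃0 oriented counterclockwise in D stays so in D′ (region-monotone):
-- otherwise its flow ±1 would equal a difference of nonnegative weights with
-- the wrong one zero.  If Dmax disagreed with F̃0 on a non-rigid edge e, no D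
-- could agree with it on e, and if Dmin agreed, every D would; either way all
-- of O(G, D0) orients e alike, i.e. e is rigid, a contradiction.

open import Defs
open import Data.Nat using (ℕ; zero; suc; _<_; _≤_; _∸_)
  renaming (_+_ to _+ℕ_; _*_ to _*ℕ_)
open import Data.Nat.Properties
  using (n<1+n; +-suc; m+[n∸m]≡n; m≤n+m; ≤-trans; ≤-pred; <-≤-trans; m∸n+n≡m; m≤m*n; +-0-monoid; *-zeroʳ)
open import Data.Nat.DivMod using (_%_; _/_; m≡m%n+[m/n]*n; m%n<n)
open import Data.Fin using (Fin; toℕ; combine)
import Data.Fin as Fin
open import Data.Fin.Properties using (pigeonhole; combine-injective; toℕ<n)
open import Data.Bool using (Bool; true; false; not)
open import Data.Bool.Properties using (not-involutive; ¬-not; _≟_)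
open import Data.Integer using (ℤ; +_; _+_; _-_; _*_; 0ℤ)
open import Data.Integer.Properties using (pos-+; pos-*; +-injective; i-j≡0⇒i≡j)
open import Data.Integer.Tactic.RingSolver using (solve-∀)
open import Data.Empty using (⊥-elim)
open import Relation.Nullary using (¬_; Dec; yes; no)
open import Algebra.Properties.Monoid.Sum +-0-monoid using (sum; sum-cong-≗; sum-replicate-zero)
open import Data.Product using (∃-syntax; _×_; _,_; proj₁; proj₂)
open import Data.List.Membership.Propositional using (find; lose)
open import Data.List.Membership.Propositional.Properties using (∈-upTo⁺)
open import Function using (Inverse; _∘_)
open import Relation.Binary.PropositionalEquality
  using (_≡_; refl; sym; trans; cong; cong₂; subst; module ≡-Reasoning)

-- Since φ is
-- injective on the finite set of 2m darts, every orbit is a cycle of length at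
-- most 2m; hence "lying on the facial walk of" is an equivalence relation.
module FacialWalks (G : Map) where
  private
    M : ℕ
    M = m G
    φ^ : ℕ → Dart M → Dart M
    φ^ = iter G

  Orbit : Dart M → Dart M → Set
  Orbit d x = ∃[ n ] φ^ n d ≡ x

  iter-+ : ∀ a b d → φ^ (a +ℕ b) d ≡ φ^ a (φ^ b d)
  iter-+ zero    b d = refl
  iter-+ (suc a) b d = cong (φ G) (iter-+ a b d)

  iter-* : ∀ p d → φ^ p d ≡ d → ∀ k → φ^ (k *ℕ p) d ≡ d
  iter-* p d fixed zero    = refl
  iter-* p d fixed (suc k) = begin
    φ^ (p +ℕ k *ℕ p) d  ≡⟨ iter-+ p (k *ℕ p) d ⟩
    φ^ p (φ^ (k *ℕ p) d) ≡⟨ cong (φ^ p) (iter-* p d fixed k) ⟩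
    φ^ p d               ≡⟨ fixed ⟩
    d                    ∎
    where open ≡-Reasoning

  φ-injective : ∀ {x y} → φ G x ≡ φ G y → x ≡ y
  φ-injective {x} {y} eq = begin
    x             ≡⟨ α-involutive x ⟨
    α (α x)       ≡⟨ cong α (σ-injective eq) ⟩
    α (α y)       ≡⟨ α-involutive y ⟩
    y             ∎
    where
      open ≡-Reasoning
      α-involutive : ∀ (d : Dart M) → α (α d) ≡ d
      α-involutive (e , b) = cong (e ,_) (not-involutive b)
      σ-injective : ∀ {u v} → σ G u ≡ σ G v → u ≡ v
      σ-injective {u} {v} eq′ = trans (sym (Inverse.strictlyInverseʳ (rot G) u))
        (trans (cong (Inverse.from (rot G)) eq′) (Inverse.strictlyInverseʳ (rot G) v))

  iter-injective : ∀ i {x y} → φ^ i x ≡ φ^ i y → x ≡ y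
  iter-injective zero    eq = eq
  iter-injective (suc i) eq = iter-injective i (φ-injective eq)

  bit : Bool → Fin 2
  bit false = Fin.zero
  bit true  = Fin.suc Fin.zero

  bit-injective : ∀ {b b′} → bit b ≡ bit b′ → b ≡ b′
  bit-injective {false} {false} _ = refl
  bit-injective {true}  {true}  _ = refl

  encode : Dart M → Fin (2 *ℕ M)
  encode (e , b) = combine (bit b) e

  encode-injective : ∀ {x y} → encode x ≡ encode y → x ≡ y
  encode-injective {e , b} {e′ , b′} eq with combine-injective (bit b) e (bit b′) e′ eq
  ... | same-bit , refl = cong (e ,_) (bit-injective same-bit)

  period : ∀ d → ∃[ q ] (suc q ≤ 2 *ℕ M × φ^ (suc q) d ≡ d)
  period d with pigeonhole (n<1+n (2 *ℕ M)) (λ k → encode (φ^ (toℕ k) d))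
  ... | i , j , i<j , eq = q , q<2M , returns
    where
      I = toℕ i
      J = toℕ j
      q = J ∸ suc I
      J≡I+q+1 : I +ℕ suc q ≡ J
      J≡I+q+1 = trans (+-suc I q) (m+[n∸m]≡n i<j)
      q<2M : suc q ≤ 2 *ℕ M
      q<2M = ≤-trans (m≤n+m (suc q) I) (subst (_≤ 2 *ℕ M) (sym J≡I+q+1) (≤-pred (toℕ<n j)))
      returns : φ^ (suc q) d ≡ d
      returns = sym (iter-injective I (begin
        φ^ I d                ≡⟨ encode-injective eq ⟩
        φ^ J d                ≡⟨ cong (λ n → φ^ n d) J≡I+q+1 ⟨
        φ^ (I +ℕ suc q) d     ≡⟨ iter-+ I (suc q) d ⟩
        φ^ I (φ^ (suc q) d)   ∎))
        where open ≡-Reasoning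

  orbit-bounded : ∀ d n → ∃[ k ] (k < 2 *ℕ M × φ^ n d ≡ φ^ k d)
  orbit-bounded d n with period d
  ... | q , q<2M , returns =
    n % suc q , <-≤-trans (m%n<n n (suc q)) q<2M , (begin
      φ^ n d                                        ≡⟨ cong (λ k → φ^ k d) (m≡m%n+[m/n]*n n (suc q)) ⟩
      φ^ (n % suc q +ℕ (n / suc q) *ℕ suc q) d      ≡⟨ iter-+ (n % suc q) _ d ⟩
      φ^ (n % suc q) (φ^ ((n / suc q) *ℕ suc q) d)  ≡⟨ cong (φ^ (n % suc q)) (iter-* (suc q) d returns (n / suc q)) ⟩
      φ^ (n % suc q) d                              ∎)
    where open ≡-Reasoning

  orbit-trans : ∀ {a b c} → Orbit a b → Orbit b c → Orbit a c
  orbit-trans {a} (i , refl) (j , refl) = j +ℕ i , iter-+ j i a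

  -- walking once more around the cycle leads back
  orbit-sym : ∀ {a b} → Orbit a b → Orbit b a
  orbit-sym {a} (k , refl) with period a
  ... | q , _ , returns = k *ℕ suc q ∸ k , (begin
    φ^ (k *ℕ suc q ∸ k) (φ^ k a)   ≡⟨ iter-+ (k *ℕ suc q ∸ k) k a ⟨
    φ^ (k *ℕ suc q ∸ k +ℕ k) a     ≡⟨ cong (λ n → φ^ n a) (m∸n+n≡m (m≤m*n k (suc q))) ⟩
    φ^ (k *ℕ suc q) a              ≡⟨ iter-* (suc q) a returns k ⟩
    a                              ∎)
    where open ≡-Reasoning

  inFace→orbit : ∀ {d x} → InFace G d x → Orbit d x
  inFace→orbit p with find p
  ... | k , _ , eq = k , eq

  orbit→inFace : ∀ {d x} → Orbit d x → InFace G d x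
  orbit→inFace {d} (n , refl) with orbit-bounded d n
  ... | k , k<2M , eq = lose (∈-upTo⁺ k<2M) (sym eq)

  inFace-trans : ∀ {a b c} → InFace G a b → InFace G b c → InFace G a c
  inFace-trans p q = orbit→inFace (orbit-trans (inFace→orbit p) (inFace→orbit q))

  inFace-sym : ∀ {a b} → InFace G a b → InFace G b a
  inFace-sym p = orbit→inFace (orbit-sym (inFace→orbit p))


count : ∀ {P : Set} → Dec P → ℕ
count (yes _) = 1
count (no _)  = 0

ind≡count : ∀ {P : Set} (p : Dec P) → ind p ≡ + count p
ind≡count (yes _) = refl
ind≡count (no _)  = refl

count-cong : ∀ {P Q : Set} (p : Dec P) (q : Dec Q) → (P → Q) → (Q → P) → count p ≡ count q
count-cong (yes _) (yes _) _   _   = refl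
count-cong (no _)  (no _)  _   _   = refl
count-cong (yes x) (no ¬y) P→Q _   = ⊥-elim (¬y (P→Q x))
count-cong (no ¬x) (yes y) _   Q→P = ⊥-elim (¬x (Q→P y))

sum-zero : ∀ n {f : Fin n → ℕ} → (∀ i → f i ≡ 0) → sum f ≡ 0
sum-zero n f≡0 = trans (sum-cong-≗ f≡0) (sum-replicate-zero n)

diff-+ : ∀ a b s t → (+ a - + b) + (+ s - + t) ≡ + (a +ℕ s) - + (b +ℕ t)
diff-+ a b s t = trans (interchange (+ a) (+ b) (+ s) (+ t))
                       (cong₂ _-_ (sym (pos-+ a s)) (sym (pos-+ b t)))
  where
    interchange : ∀ (a b s t : ℤ) → (a - b) + (s - t) ≡ (a + s) - (b + t)
    interchange = solve-∀

sumFin-diff : ∀ n (f : Fin n → ℤ) (g h : Fin n → ℕ) →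
  (∀ i → f i ≡ + g i - + h i) → sumFin n f ≡ + sum g - + sum h
sumFin-diff zero    f g h f≡g-h = refl
sumFin-diff (suc n) f g h f≡g-h = trans
  (cong₂ _+_ (f≡g-h Fin.zero) (sumFin-diff n (f ∘ Fin.suc) (g ∘ Fin.suc) (h ∘ Fin.suc) (f≡g-h ∘ Fin.suc)))
  (diff-+ (g Fin.zero) (h Fin.zero) (sum (g ∘ Fin.suc)) (sum (h ∘ Fin.suc)))

scaled-indicators : ∀ {P Q : Set} k (p : Dec P) (q : Dec Q) →
  + k * (ind p - ind q) ≡ + (k *ℕ count p) - + (k *ℕ count q)
scaled-indicators k p q = begin
  + k * (ind p - ind q)                ≡⟨ cong₂ (λ a b → + k * (a - b)) (ind≡count p) (ind≡count q) ⟩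
  + k * (+ count p - + count q)        ≡⟨ distrib (+ k) (+ count p) (+ count q) ⟩
  + k * + count p - + k * + count q    ≡⟨ cong₂ _-_ (pos-* k (count p)) (pos-* k (count q)) ⟨
  + (k *ℕ count p) - + (k *ℕ count q)  ∎
  where
    open ≡-Reasoning
    distrib : ∀ (x a b : ℤ) → x * (a - b) ≡ x * a - x * b
    distrib = solve-∀

module FaceWeights (G : Map) (c : Dart (m G) → ℕ) where
  private
    M : ℕ
    M = m G
  open FacialWalks G

  contribution : Dart M → Dart M → ℕ
  contribution d x = c d *ℕ count (inFace? G d x)

  summand : Dart M → Fin M → ℕ
  summand x e = contribution (e , true) x +ℕ contribution (e , false) x

  weight : Dart M → ℕ
  weight x = sum (summand x)

  combo≡weights : ∀ e → combo G (+_ ∘ c) e ≡ + weight (e , true) - + weight (e , false)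
  combo≡weights e = sumFin-diff M _ (summand (e , true)) (summand (e , false)) per-edge
    where
      per-edge : ∀ e′ → + c (e′ , true) * faceFlow G (e′ , true) e + + c (e′ , false) * faceFlow G (e′ , false) e
                        ≡ + summand (e , true) e′ - + summand (e , false) e′
      per-edge e′ = trans
        (cong₂ _+_ (scaled-indicators (c (e′ , true)) (inFace? G (e′ , true) (e , true)) (inFace? G (e′ , true) (e , false)))
                   (scaled-indicators (c (e′ , false)) (inFace? G (e′ , false) (e , true)) (inFace? G (e′ , false) (e , false))))
        (diff-+ (contribution (e′ , true) (e , true)) (contribution (e′ , true) (e , false))
                (contribution (e′ , false) (e , true)) (contribution (e′ , false) (e , false)))

  weight-along : ∀ {x x′} → InFace G x x′ → weight x ≡ weight x′
  weight-along {x} {x′} x~x′ = sum-cong-≗ (λ e → cong₂ _+ℕ_ (same (e , true)) (same (e , false)))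
    where
      same : ∀ d → contribution d x ≡ contribution d x′
      same d = cong (c d *ℕ_) (count-cong (inFace? G d x) (inFace? G d x′)
        (λ d~x → inFace-trans d~x x~x′) (λ d~x′ → inFace-trans d~x′ (inFace-sym x~x′)))

  weight-outer : ∀ {d0 x} → (∀ d → InFace G d0 d → c d ≡ 0) → InFace G d0 x → weight x ≡ 0
  weight-outer {d0} {x} c-outer≡0 d0~x = sum-zero M (λ e → cong₂ _+ℕ_ (vanish (e , true)) (vanish (e , false)))
    where
      vanish : ∀ d → contribution d x ≡ 0
      vanish d with inFace? G d x
      ... | yes d~x = cong (_*ℕ 1) (c-outer≡0 d (inFace-trans d0~x (inFace-sym d~x)))
      ... | no _    = *-zeroʳ (c d)

diffFlow-agree : ∀ {n} (D D′ : Orientation n) e → D e ≡ D′ e → diffFlow D D′ e ≡ 0ℤ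
diffFlow-agree D D′ e same with D e | D′ e
diffFlow-agree D D′ e refl | true  | .true  = refl
diffFlow-agree D D′ e refl | false | .false = refl

diffFlow-disagree : ∀ {n} (D D′ : Orientation n) e b → D e ≡ b → ¬ D′ e ≡ b → diffFlow D D′ e ≡ sign b
diffFlow-disagree D D′ e b D≡b D′≢b with D e | D′ e
diffFlow-disagree D D′ e true  refl D′≢b | .true  | true  = ⊥-elim (D′≢b refl)
diffFlow-disagree D D′ e true  refl D′≢b | .true  | false = refl
diffFlow-disagree D D′ e false refl D′≢b | .false | true  = refl
diffFlow-disagree D D′ e false refl D′≢b | .false | false = ⊥-elim (D′≢b refl)

sign≢weights : ∀ b (w : Bool → ℕ) → w b ≡ 0 → ¬ sign b ≡ + w true - + w false
sign≢weights true  w w≡0 eq with w true | w false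
sign≢weights true  w refl () | .0 | zero
sign≢weights true  w refl () | .0 | suc _
sign≢weights false w w≡0 eq with w true | w false
sign≢weights false w refl () | zero  | .0
sign≢weights false w refl () | suc _ | .0

module Monotonicity (G : Map) (D0 : Orientation (m G)) (d0 : Dart (m G))
  (D D′ : Orientation (m G)) (D∈O : InO G D0 D) (D′∈O : InO G D0 D′)
  (c : Dart (m G) → ℕ) (c-outer≡0 : ∀ d → InFace G d0 d → c d ≡ 0)
  (D∖D′≡combo : ∀ e → diffFlow D D′ e ≡ combo G (+_ ∘ c) e) where

  open FaceWeights G c

  flow≡weights : ∀ e → diffFlow D D′ e ≡ + weight (e , true) - + weight (e , false)
  flow≡weights e = trans (D∖D′≡combo e) (combo≡weights e)

  -- no flow crosses a rigid edge, so both its darts weigh the same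
  weight-rigid : ∀ e → Rigid G D0 e → weight (e , true) ≡ weight (e , false)
  weight-rigid e rigid = +-injective (i-j≡0⇒i≡j _ _
    (trans (sym (flow≡weights e)) (diffFlow-agree D D′ e (rigid D D′ D∈O D′∈O))))

  weight-region : ∀ {d} → InRegion G D0 d0 d → weight d ≡ 0
  weight-region (base d0~d)                  = weight-outer c-outer≡0 d0~d
  weight-region (cross {e , true}  reg rigid) = trans (sym (weight-rigid e rigid)) (weight-region reg)
  weight-region (cross {e , false} reg rigid) = trans (weight-rigid e rigid) (weight-region reg)
  weight-region (along reg d~d′)             = trans (sym (weight-along d~d′)) (weight-region reg)

  persists : ∀ e b → InRegion G D0 d0 (e , b) → D e ≡ b → D′ e ≡ b
  persists e b reg D≡b with D′ e ≟ b
  ... | yes D′≡b = D′≡b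
  ... | no  D′≢b = ⊥-elim (sign≢weights b (λ b′ → weight (e , b′)) (weight-region reg)
                     (trans (sym (diffFlow-disagree D D′ e b D≡b D′≢b)) (flow≡weights e)))

region-monotone : ∀ (G : Map) D0 d0 (D D′ : Orientation (m G)) →
  InO G D0 D → InO G D0 D′ → Leq G d0 D D′ →
  ∀ e b → InRegion G D0 d0 (e , b) → D e ≡ b → D′ e ≡ b
region-monotone G D0 d0 D D′ D∈O D′∈O (c , c-outer≡0 , D∖D′≡combo) =
  Monotonicity.persists G D0 d0 D D′ D∈O D′∈O c c-outer≡0 D∖D′≡combo

constant→rigid : ∀ (G : Map) D0 e x → (∀ D → InO G D0 D → D e ≡ x) → Rigid G D0 e
constant→rigid G D0 e x constant D D′ D∈O D′∈O = trans (constant D D∈O) (sym (constant D′ D′∈O))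

proposition38 : (G : Map) (D0 : Orientation (m G)) (d0 : Dart (m G))
    (Dmax Dmin : Orientation (m G)) →
    InO G D0 Dmax → (∀ D → InO G D0 D → Leq G d0 D Dmax) →
    InO G D0 Dmin → (∀ D → InO G D0 D → Leq G d0 Dmin D) →
    (∀ d → InF̃0 G D0 d0 d → Dmax (proj₁ d) ≡ proj₂ d)
    × (∀ d → InF̃0 G D0 d0 d → Dmin (proj₁ d) ≡ not (proj₂ d))
proposition38 G D0 d0 Dmax Dmin Dmax∈O maximal Dmin∈O minimal = max-along , min-against
  where
    -- if Dmax disagreed with F̃0 on e, no D ≤ Dmax could agree, so e would be rigid
    max-along : ∀ d → InF̃0 G D0 d0 d → Dmax (proj₁ d) ≡ proj₂ d
    max-along (e , b) (reg , non-rigid) with Dmax e ≟ b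
    ... | yes Dmax≡b = Dmax≡b
    ... | no  Dmax≢b = ⊥-elim (non-rigid (constant→rigid G D0 e (not b) λ D D∈O →
            ¬-not λ D≡b → Dmax≢b (region-monotone G D0 d0 D Dmax D∈O Dmax∈O (maximal D D∈O) e b reg D≡b)))
    -- if Dmin agreed with F̃0 on e, every D ≥ Dmin would agree, so e would be rigid
    min-against : ∀ d → InF̃0 G D0 d0 d → Dmin (proj₁ d) ≡ not (proj₂ d)
    min-against (e , b) (reg , non-rigid) = ¬-not λ Dmin≡b → non-rigid (constant→rigid G D0 e b λ D D∈O →
            region-monotone G D0 d0 Dmin D Dmin∈O D∈O (minimal D D∈O) e b reg Dmin≡b)
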